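{- Let $a,b,d\in\mathbb N$. Then $([a]\times[b],d)$ is irreducible if and only if $a=b\ge d$.
   Context: $\mathbb N=\{1,2,\dots\}$, $[m]=\{1,\dots,m\}$. A Ferrers diagram is a finite $\mathcal D\subseteq\mathbb N^2$ with $(x,y)\in\mathcal D\Rightarrow(i,j)\in\mathcal D$ for all $i\in[x]$, $j\in[y]$ (row, column). $\nu_j(\mathcal D,d)=|\{(x,y)\in\mathcal D:x\ge d-j,\ y\ge j+1\}|$ for $0\le j\le d-1$, $\nu_{\min}(\mathcal D,d)=\min_j\nu_j(\mathcal D,d)$. For $P\in\mathcal D$ such that $\mathcal D'=\mathcal D\setminus\{P\}$ is a Ferrers diagram: if $\nu_{\min}(\mathcal D',d)=\nu_{\min}(\mathcal D,d)$ write $\mathcal D'\xrightarrow{d}\mathcal D$, otherwise $\mathcal D\xrightarrow{d}\mathcal D'$. $(\mathcal D,d)$ is irreducible if there is no Ferrers diagram $\mathcal D'$ with $\mathcal D'\xrightarrow{d}\mathcal D$. -}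

module Defs where

open import Data.Bool using (Bool; true; false; _∧_; not; T; if_then_else_)
open import Data.Bool.Properties using (T-∧)
open import Data.Nat using (ℕ; zero; suc; _+_; _∸_; _≤_; _⊔_; _⊓_; _≤ᵇ_; _≡ᵇ_)
open import Data.Nat.Properties using (≤ᵇ⇒≤; ≤⇒≤ᵇ; ≤-trans; m≤m⊔n; m≤n⊔m)
open import Data.Product using (Σ; _×_; _,_; proj₁; proj₂)
open import Data.Sum using (_⊎_)
open import Function.Bundles using (Equivalence)
open import Relation.Binary.PropositionalEquality using (_≡_; _≢_)
open import Relation.Nullary using (¬_)

open Equivalence

-- A Ferrers diagram: a finite subset of ℕ₊ × ℕ₊ (ℕ = {1,2,…}), given by a
-- Boolean membership test, a bound witnessing finiteness, and the
-- down-closure property  (x,y) ∈ D ⇒ (i,j) ∈ D  for i ∈ [x], j ∈ [y].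
-- Coordinates are (row, column).
record Ferrers : Set where
  field
    mem      : ℕ → ℕ → Bool
    bound    : ℕ
    bounded  : ∀ {x y} → T (mem x y) → x ≤ bound × y ≤ bound
    positive : ∀ {x y} → T (mem x y) → 1 ≤ x × 1 ≤ y
    downward : ∀ {x y i j} → T (mem x y) → 1 ≤ i → i ≤ x → 1 ≤ j → j ≤ y
               → T (mem i j)
open Ferrers public

sumTo : ℕ → (ℕ → ℕ) → ℕ
sumTo zero    f = 0
sumTo (suc n) f = sumTo n f + f (suc n)

minUpTo : ℕ → (ℕ → ℕ) → ℕ
minUpTo zero    f = f 0
minUpTo (suc k) f = minUpTo k f ⊓ f (suc k)

-- ν_j(D,d) = |{(x,y) ∈ D : x ≥ d - j, y ≥ j + 1}|
-- (all points of D lie in [bound] × [bound], so counting there is exact)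
ν : Ferrers → ℕ → ℕ → ℕ
ν D d j = sumTo (bound D) λ x → sumTo (bound D) λ y →
  if mem D x y ∧ ((d ∸ j) ≤ᵇ x) ∧ (suc j ≤ᵇ y) then 1 else 0

-- ν_min(D,d) = min_{0 ≤ j ≤ d-1} ν_j(D,d)   (only used for d ≥ 1)
νmin : Ferrers → ℕ → ℕ
νmin D zero    = 0
νmin D (suc k) = minUpTo k (ν D (suc k))

Removal : Ferrers → ℕ × ℕ → Ferrers → Set
Removal D (p , q) D' =
  T (mem D p q) ×
  (∀ x y → mem D' x y ≡ (mem D x y ∧ not ((x ≡ᵇ p) ∧ (y ≡ᵇ q))))

infix 4 _⟶[_]_
_⟶[_]_ : Ferrers → ℕ → Ferrers → Set
D₁ ⟶[ d ] D₂ =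
  (Σ (ℕ × ℕ) λ P → Removal D₂ P D₁ × νmin D₁ d ≡ νmin D₂ d)
  ⊎ (Σ (ℕ × ℕ) λ P → Removal D₁ P D₂ × νmin D₂ d ≢ νmin D₁ d)

Irreducible : Ferrers → ℕ → Set
Irreducible D d = ¬ (Σ Ferrers λ D' → D' ⟶[ d ] D)

private
  unpack4 : ∀ p q r s → T (p ∧ q ∧ r ∧ s) → T p × T q × T r × T s
  unpack4 true true true true _ = _ , _ , _ , _
  unpack4 true true true false ()
  unpack4 true true false _ ()
  unpack4 true false _ _ ()
  unpack4 false _ _ _ ()

  pack4 : ∀ {p q r s} → T p → T q → T r → T s → T (p ∧ q ∧ r ∧ s)
  pack4 {true} {true} {true} {true} _ _ _ _ = _

rectMem : ℕ → ℕ → ℕ → ℕ → Bool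
rectMem a b x y = (1 ≤ᵇ x) ∧ (x ≤ᵇ a) ∧ (1 ≤ᵇ y) ∧ (y ≤ᵇ b)

rect : ℕ → ℕ → Ferrers
rect a b = record
  { mem      = rectMem a b
  ; bound    = a ⊔ b
  ; bounded  = λ {x} {y} h → let (_ , h₂ , _ , h₄) = unpack4 (1 ≤ᵇ x) (x ≤ᵇ a) (1 ≤ᵇ y) (y ≤ᵇ b) h in
      ≤-trans (≤ᵇ⇒≤ x a h₂) (m≤m⊔n a b) , ≤-trans (≤ᵇ⇒≤ y b h₄) (m≤n⊔m a b)
  ; positive = λ {x} {y} h → let (h₁ , _ , h₃ , _) = unpack4 (1 ≤ᵇ x) (x ≤ᵇ a) (1 ≤ᵇ y) (y ≤ᵇ b) h in
      ≤ᵇ⇒≤ 1 x h₁ , ≤ᵇ⇒≤ 1 y h₃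
  ; downward = λ {x} {y} {i} {j} h 1≤i i≤x 1≤j j≤y →
      let (_ , h₂ , _ , h₄) = unpack4 (1 ≤ᵇ x) (x ≤ᵇ a) (1 ≤ᵇ y) (y ≤ᵇ b) h in
      pack4 {1 ≤ᵇ i} {i ≤ᵇ a} {1 ≤ᵇ j} {j ≤ᵇ b} (≤⇒≤ᵇ 1≤i)
        (≤⇒≤ᵇ (≤-trans i≤x (≤ᵇ⇒≤ x a h₂)))
        (≤⇒≤ᵇ 1≤j) (≤⇒≤ᵇ (≤-trans j≤y (≤ᵇ⇒≤ y b h₄)))
  }

{-# OPTIONS --safe #-}
-- ν_j(D,d) counts the cells of D in the quadrant of rows ≥ d − j and columns ≥ j + 1,
-- so adding or removing a cell P changes ν_j by one exactly when P lies in that quadrant.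
-- For the rectangle, ν_j = (a + 1 − d + j)(b − j), a product of two factors with constant
-- sum. If d > a or d > b some ν_j vanishes, so deleting the corner (a,b) leaves ν_min = 0.
-- If d ≤ a < b the minimum is attained only at j = 0, so adding the cell (a+1,1), which
-- only ν_0 counts, raises ν_min; symmetrically for d ≤ b < a with (1,b+1) and j = d − 1.
-- For a = b ≥ d, the only removable cell (a,a) lies in every quadrant, so removing it
-- lowers ν_min; the only addable cells (a+1,1) and (1,a+1) are counted by ν_0 resp.
-- ν_{d−1} alone, and ν_0 = ν_{d−1} for a square, so adding either keeps ν_min.
module Submission where

open import Defs
open import Data.Bool using (Bool; true; false; _∧_; _∨_; not; T; if_then_else_)
open import Data.Bool.Properties using (T-∧; T-∨)
open import Data.Nat
  using (ℕ; zero; suc; _+_; _*_; _∸_; _≤_; _<_; _≤ᵇ_; _≡ᵇ_; _⊔_; _⊓_; z≤n; s≤s; _≟_; _≤?_)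
open import Data.Nat.Properties
open import Algebra.Properties.CommutativeSemigroup +-commutativeSemigroup
  using () renaming (interchange to +-interchange)
open import Data.Product using (_×_; _,_; proj₁; proj₂)
open import Data.Sum using (_⊎_; inj₁; inj₂; map₂)
open import Function using (_∘_)
open import Function.Bundles using (_⇔_; Equivalence; mk⇔)
open import Relation.Binary.PropositionalEquality
  using (_≡_; _≢_; refl; sym; trans; cong; cong₂; subst; module ≡-Reasoning)
open import Relation.Nullary using (¬_; yes; no; contradiction)
open import Relation.Nullary.Decidable using (_×-dec_; decidable-stable)

open Equivalence using (to; from)

private
  variable
    a b j k p q x y K : ℕ
    f g : ℕ → ℕ
    D D′ E : Ferrers

m∸[n∸o]≡m∸n+o : ∀ {m n o} → o ≤ n → n ≤ m → m ∸ (n ∸ o) ≡ m ∸ n + o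
m∸[n∸o]≡m∸n+o {m} {n} {o} o≤n n≤m = begin
  m ∸ (n ∸ o)                  ≡⟨ cong (_∸ (n ∸ o)) (m∸n+n≡m n≤m) ⟨
  (m ∸ n + n) ∸ (n ∸ o)        ≡⟨ +-∸-assoc (m ∸ n) (m∸n≤m n o) ⟩
  m ∸ n + (n ∸ (n ∸ o))        ≡⟨ cong (m ∸ n +_) (m∸[m∸n]≡n o≤n) ⟩
  m ∸ n + o                    ∎
  where open ≡-Reasoning

m*[n+o]<[m+o]*n : ∀ {m n o} → m < n → 1 ≤ o → m * (n + o) < (m + o) * n
m*[n+o]<[m+o]*n {m} {n} {suc o} m<n _ = begin-strict
  m * (n + suc o)       ≡⟨ *-distribˡ-+ m n (suc o) ⟩
  m * n + m * suc o     <⟨ +-monoʳ-< (m * n) (*-monoˡ-< (suc o) m<n) ⟩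
  m * n + n * suc o     ≡⟨ cong (m * n +_) (*-comm n (suc o)) ⟩
  m * n + suc o * n     ≡⟨ *-distribʳ-+ n m (suc o) ⟨
  (m + suc o) * n       ∎
  where open ≤-Reasoning

-- Iverson brackets and finite sums

iverson : Bool → ℕ
iverson b = if b then 1 else 0

iverson-T : ∀ {b} → T b → iverson b ≡ 1
iverson-T {true} _ = refl

iverson-¬T : ∀ {b} → ¬ T b → iverson b ≡ 0
iverson-¬T {true} ¬t = contradiction _ ¬t
iverson-¬T {false} _ = refl

iverson-T∧ : ∀ {b} c → T b → iverson (b ∧ c) ≡ iverson c
iverson-T∧ {true} _ _ = refl

iverson-∧ : ∀ u v → iverson (u ∧ v) ≡ iverson u * iverson v
iverson-∧ true  v = sym (*-identityˡ (iverson v))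
iverson-∧ false v = refl

iverson-medial : ∀ u v w z → iverson ((u ∧ v) ∧ (w ∧ z)) ≡ iverson (u ∧ w) * iverson (v ∧ z)
iverson-medial true  true  w z = iverson-∧ w z
iverson-medial true  false w z = sym (*-zeroʳ (iverson w))
iverson-medial false v     w z = refl

iverson-split : ∀ m e r → (T e → T m) →
                iverson ((m ∧ not e) ∧ r) + iverson (e ∧ r) ≡ iverson (m ∧ r)
iverson-split true  true  r _ = refl
iverson-split true  false r _ = +-identityʳ (iverson r)
iverson-split false true  r e⇒m = contradiction (e⇒m _) λ ()
iverson-split false false r _ = refl

T-not : ∀ {b} → ¬ T b → T (not b)
T-not {true}  ¬t = ¬t _
T-not {false} _  = _

T-not⇒¬T : ∀ {b} → T (not b) → ¬ T b
T-not⇒¬T {true} ()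

sumTo-cong : ∀ n → (∀ m → m < n → f (suc m) ≡ g (suc m)) → sumTo n f ≡ sumTo n g
sumTo-cong zero _ = refl
sumTo-cong (suc n) f≗g = cong₂ _+_ (sumTo-cong n λ m m<n → f≗g m (m<n⇒m<1+n m<n)) (f≗g n ≤-refl)

sumTo-zero : ∀ n → (∀ m → m < n → f (suc m) ≡ 0) → sumTo n f ≡ 0
sumTo-zero zero _ = refl
sumTo-zero (suc n) f≡0 = cong₂ _+_ (sumTo-zero n λ m m<n → f≡0 m (m<n⇒m<1+n m<n)) (f≡0 n ≤-refl)

sumTo-+ : ∀ n → sumTo n (λ x → f x + g x) ≡ sumTo n f + sumTo n g
sumTo-+ zero = refl
sumTo-+ {f} {g} (suc n) = begin
  sumTo n (λ x → f x + g x) + (f (suc n) + g (suc n))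
    ≡⟨ cong (_+ (f (suc n) + g (suc n))) (sumTo-+ n) ⟩
  (sumTo n f + sumTo n g) + (f (suc n) + g (suc n))
    ≡⟨ +-interchange (sumTo n f) (sumTo n g) (f (suc n)) (g (suc n)) ⟩
  (sumTo n f + f (suc n)) + (sumTo n g + g (suc n)) ∎
  where open ≡-Reasoning

sumTo-*ˡ : ∀ n c → sumTo n (λ x → c * f x) ≡ c * sumTo n f
sumTo-*ˡ zero c = sym (*-zeroʳ c)
sumTo-*ˡ {f} (suc n) c =
  trans (cong (_+ c * f (suc n)) (sumTo-*ˡ n c)) (sym (*-distribˡ-+ c (sumTo n f) (f (suc n))))

sumTo-*ʳ : ∀ n c → sumTo n (λ x → f x * c) ≡ sumTo n f * c
sumTo-*ʳ zero c = refl
sumTo-*ʳ {f} (suc n) c =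
  trans (cong (_+ f (suc n) * c) (sumTo-*ʳ n c)) (sym (*-distribʳ-+ c (sumTo n f) (f (suc n))))

sumTo-extend : ∀ n m → n ≤ m → (∀ x → n < x → f x ≡ 0) → sumTo m f ≡ sumTo n f
sumTo-extend n zero z≤n _ = refl
sumTo-extend {f} n (suc m) n≤1+m f≡0 with n ≤? m
... | yes n≤m =
  trans (cong₂ _+_ (sumTo-extend n m n≤m f≡0) (f≡0 (suc m) (s≤s n≤m))) (+-identityʳ (sumTo n f))
... | no n≰m rewrite ≤-antisym n≤1+m (≰⇒> n≰m) = refl

sumTo-single : ∀ n → 1 ≤ p → p ≤ n → (∀ x → x ≢ p → f x ≡ 0) → sumTo n f ≡ f p
sumTo-single zero (s≤s _) () _
sumTo-single {p} {f} (suc n) 1≤p p≤1+n f≡0 with p ≟ suc n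
... | yes refl = cong (_+ f p) (sumTo-zero n λ m m<n → f≡0 (suc m) (<⇒≢ (s≤s m<n)))
... | no p≢1+n = begin
  sumTo n f + f (suc n)    ≡⟨ cong₂ _+_ (sumTo-single n 1≤p p≤n f≡0) (f≡0 (suc n) (p≢1+n ∘ sym)) ⟩
  f p + 0                  ≡⟨ +-identityʳ (f p) ⟩
  f p                      ∎
  where
  open ≡-Reasoning
  p≤n : p ≤ n
  p≤n = ≤-pred (≤∧≢⇒< p≤1+n p≢1+n)

sumTo-≥ : ∀ n {l} → 1 ≤ l → sumTo n (λ x → iverson (l ≤ᵇ x)) ≡ suc n ∸ l
sumTo-≥ zero {suc l} _ = sym (0∸n≡0 l)
sumTo-≥ (suc n) {l} 1≤l with l ≤? suc n
... | yes l≤1+n = begin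
  sumTo n (λ x → iverson (l ≤ᵇ x)) + iverson (l ≤ᵇ suc n)
    ≡⟨ cong₂ _+_ (sumTo-≥ n 1≤l) (iverson-T (≤⇒≤ᵇ l≤1+n)) ⟩
  (suc n ∸ l) + 1
    ≡⟨ +-comm _ 1 ⟩
  1 + (suc n ∸ l)
    ≡⟨ +-∸-assoc 1 l≤1+n ⟨
  suc (suc n) ∸ l ∎
  where open ≡-Reasoning
... | no l≰1+n = begin
  sumTo n (λ x → iverson (l ≤ᵇ x)) + iverson (l ≤ᵇ suc n)
    ≡⟨ cong₂ _+_ (sumTo-≥ n 1≤l) (iverson-¬T (l≰1+n ∘ ≤ᵇ⇒≤ l (suc n))) ⟩
  (suc n ∸ l) + 0
    ≡⟨ +-identityʳ _ ⟩
  suc n ∸ l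
    ≡⟨ m≤n⇒m∸n≡0 (<⇒≤ (≰⇒> l≰1+n)) ⟩
  0
    ≡⟨ m≤n⇒m∸n≡0 (≰⇒> l≰1+n) ⟨
  suc (suc n) ∸ l ∎
  where open ≡-Reasoning

sumTo-interval : ∀ n a {l} → 1 ≤ l → a ≤ n →
                 sumTo n (λ x → iverson ((x ≤ᵇ a) ∧ (l ≤ᵇ x))) ≡ suc a ∸ l
sumTo-interval n a {l} 1≤l a≤n = begin
  sumTo n (λ x → iverson ((x ≤ᵇ a) ∧ (l ≤ᵇ x)))
    ≡⟨ sumTo-extend a n a≤n (λ x a<x → iverson-¬T λ t →
         <⇒≱ a<x (≤ᵇ⇒≤ x a (proj₁ (T-∧ .to t)))) ⟩
  sumTo a (λ x → iverson ((x ≤ᵇ a) ∧ (l ≤ᵇ x)))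
    ≡⟨ sumTo-cong a (λ m m<a → iverson-T∧ (l ≤ᵇ suc m) (≤⇒≤ᵇ m<a)) ⟩
  sumTo a (λ x → iverson (l ≤ᵇ x))
    ≡⟨ sumTo-≥ a 1≤l ⟩
  suc a ∸ l ∎
  where open ≡-Reasoning

count : ℕ → (ℕ → ℕ → Bool) → ℕ
count K A = sumTo K λ x → sumTo K λ y → iverson (A x y)

count-+ : ∀ K (A₁ A₂ A : ℕ → ℕ → Bool) →
          (∀ x y → iverson (A₁ x y) + iverson (A₂ x y) ≡ iverson (A x y)) →
          count K A₁ + count K A₂ ≡ count K A
count-+ K A₁ A₂ A pointwise = begin
  count K A₁ + count K A₂
    ≡⟨ sumTo-+ K ⟨
  sumTo K (λ x → sumTo K (λ y → iverson (A₁ x y)) + sumTo K (λ y → iverson (A₂ x y)))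
    ≡⟨ sumTo-cong K (λ x _ → sumTo-+ K) ⟨
  sumTo K (λ x → sumTo K (λ y → iverson (A₁ x y) + iverson (A₂ x y)))
    ≡⟨ sumTo-cong K (λ x _ → sumTo-cong K λ y _ → pointwise (suc x) (suc y)) ⟩
  count K A ∎
  where open ≡-Reasoning

count-extend : ∀ B K (A : ℕ → ℕ → Bool) → (∀ {x y} → T (A x y) → x ≤ B × y ≤ B) → B ≤ K →
               count K A ≡ count B A
count-extend B K A bounded B≤K = begin
  sumTo K (λ x → sumTo K (λ y → iverson (A x y)))
    ≡⟨ sumTo-cong K (λ _ _ → sumTo-extend B K B≤K λ y B<y →
         iverson-¬T λ t → <⇒≱ B<y (proj₂ (bounded t))) ⟩
  sumTo K (λ x → sumTo B (λ y → iverson (A x y)))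
    ≡⟨ sumTo-extend B K B≤K (λ x B<x → sumTo-zero B λ _ _ →
         iverson-¬T λ t → <⇒≱ B<x (proj₁ (bounded t))) ⟩
  count B A ∎
  where open ≡-Reasoning

minUpTo-≤ : ∀ k f {i} → i ≤ k → minUpTo k f ≤ f i
minUpTo-≤ zero f z≤n = ≤-refl
minUpTo-≤ (suc k) f {i} i≤1+k with i ≟ suc k
... | yes refl = m⊓n≤n _ _
... | no i≢1+k = ≤-trans (m⊓n≤m _ _) (minUpTo-≤ k f (≤-pred (≤∧≢⇒< i≤1+k i≢1+k)))

minUpTo-glb : ∀ k f {m} → (∀ i → i ≤ k → m ≤ f i) → m ≤ minUpTo k f
minUpTo-glb zero f m≤f = m≤f 0 z≤n
minUpTo-glb (suc k) f m≤f =
  ⊓-glb (minUpTo-glb k f λ i i≤k → m≤f i (m≤n⇒m≤1+n i≤k)) (m≤f (suc k) ≤-refl)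

minUpTo-mono-≤ : ∀ k f g → (∀ i → i ≤ k → f i ≤ g i) → minUpTo k f ≤ minUpTo k g
minUpTo-mono-≤ k f g f≤g = minUpTo-glb k g λ i i≤k → ≤-trans (minUpTo-≤ k f i≤k) (f≤g i i≤k)

minUpTo-suc : ∀ k f g → (∀ i → i ≤ k → g i ≡ suc (f i)) → minUpTo k g ≡ suc (minUpTo k f)
minUpTo-suc zero f g g≡1+f = g≡1+f 0 z≤n
minUpTo-suc (suc k) f g g≡1+f =
  cong₂ _⊓_ (minUpTo-suc k f g λ i i≤k → g≡1+f i (m≤n⇒m≤1+n i≤k)) (g≡1+f (suc k) ≤-refl)

minUpTo-raise : ∀ k f g {s t} → s ≤ k → s ≢ t → f s ≡ f t →
                (∀ i → i ≤ k → f i ≤ g i) → (∀ i → i ≤ k → i ≢ t → g i ≡ f i) →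
                minUpTo k g ≡ minUpTo k f
minUpTo-raise k f g {s} {t} s≤k s≢t fs≡ft f≤g g≡f =
  ≤-antisym (minUpTo-glb k f min-g≤f) (minUpTo-mono-≤ k f g f≤g)
  where
  min-g≤f : ∀ i → i ≤ k → minUpTo k g ≤ f i
  min-g≤f i i≤k with i ≟ t
  ... | yes refl = ≤-trans (minUpTo-≤ k g s≤k) (≤-reflexive (trans (g≡f s s≤k s≢t) fs≡ft))
  ... | no i≢t = ≤-trans (minUpTo-≤ k g i≤k) (≤-reflexive (g≡f i i≤k i≢t))

-- Cells, quadrants and removable cells

-- Chosen so that Removal D (p , q) D′ unfolds to
-- T (mem D p q) × (∀ x y → mem D′ x y ≡ mem D x y ∧ not (isCell p q x y)).
isCell : ℕ → ℕ → ℕ → ℕ → Bool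
isCell p q x y = (x ≡ᵇ p) ∧ (y ≡ᵇ q)

isCell⇒≡ : T (isCell p q x y) → x ≡ p × y ≡ q
isCell⇒≡ {p} {q} {x} {y} t = ≡ᵇ⇒≡ x p (proj₁ (T-∧ .to t)) , ≡ᵇ⇒≡ y q (proj₂ (T-∧ .to t))

isCell-refl : T (isCell p q p q)
isCell-refl {p} {q} = T-∧ .from (≡⇒≡ᵇ p p refl , ≡⇒≡ᵇ q q refl)

count-cell : ∀ K (A : ℕ → ℕ → Bool) → 1 ≤ p → p ≤ K → 1 ≤ q → q ≤ K →
             count K (λ x y → isCell p q x y ∧ A x y) ≡ iverson (A p q)
count-cell {p} {q} K A 1≤p p≤K 1≤q q≤K = begin
  count K (λ x y → isCell p q x y ∧ A x y)
    ≡⟨ sumTo-single K 1≤p p≤K (λ x x≢p → sumTo-zero K λ _ _ → off-cell (x≢p ∘ proj₁)) ⟩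
  sumTo K (λ y → iverson (isCell p q p y ∧ A p y))
    ≡⟨ sumTo-single K 1≤q q≤K (λ y y≢q → off-cell (y≢q ∘ proj₂)) ⟩
  iverson (isCell p q p q ∧ A p q)
    ≡⟨ iverson-T∧ (A p q) (isCell-refl {p} {q}) ⟩
  iverson (A p q) ∎
  where
  open ≡-Reasoning
  off-cell : ∀ {x y} → ¬ (x ≡ p × y ≡ q) → iverson (isCell p q x y ∧ A x y) ≡ 0
  off-cell {x} {y} ≢cell = iverson-¬T λ t → ≢cell (isCell⇒≡ (proj₁ (T-∧ .to t)))

inQuadrant : ℕ → ℕ → ℕ → ℕ → Bool
inQuadrant d j x y = ((d ∸ j) ≤ᵇ x) ∧ (suc j ≤ᵇ y)

inQuadrant-intro : ∀ d j → d ∸ j ≤ x → suc j ≤ y → T (inQuadrant d j x y)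
inQuadrant-intro d j d∸j≤x j<y = T-∧ .from (≤⇒≤ᵇ d∸j≤x , ≤⇒≤ᵇ j<y)

inQuadrant⇒ : ∀ d j x y → T (inQuadrant d j x y) → d ∸ j ≤ x × suc j ≤ y
inQuadrant⇒ d j x y t = let (l , r) = T-∧ .to t in ≤ᵇ⇒≤ (d ∸ j) x l , ≤ᵇ⇒≤ (suc j) y r

inQuadrant-first-column : ∀ d {j x} → 1 ≤ j → ¬ T (inQuadrant d j x 1)
inQuadrant-first-column d {j} {x} (s≤s z≤n) t with proj₂ (inQuadrant⇒ d j x 1 t)
... | s≤s ()

inQuadrant-first-row : ∀ d {j y} → suc j < d → ¬ T (inQuadrant d j 1 y)
inQuadrant-first-row d {j} {y} 1+j<d t with ≤-trans 2≤d∸j (proj₁ (inQuadrant⇒ d j 1 y t))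
  where
  2≤d∸j : 2 ≤ d ∸ j
  2≤d∸j = subst (_≤ d ∸ j) (m+n∸n≡m 2 j) (∸-monoˡ-≤ j 1+j<d)
... | s≤s ()

removal-drops : Removal D (p , q) D′ → ¬ T (mem D′ p q)
removal-drops {D} {p} {q} {D′} (_ , D′≡D∖pq) pq∈D′ =
  T-not⇒¬T (proj₂ (T-∧ .to (subst T (D′≡D∖pq p q) pq∈D′))) (isCell-refl {p} {q})

removal-keeps : Removal D (p , q) D′ → T (mem D x y) → ¬ (x ≡ p × y ≡ q) → T (mem D′ x y)
removal-keeps {D} {p} {q} {D′} {x} {y} (_ , D′≡D∖pq) xy∈D xy≢pq =
  subst T (sym (D′≡D∖pq x y)) (T-∧ .from (xy∈D , T-not (xy≢pq ∘ isCell⇒≡)))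

removal-difference : Removal D (p , q) D′ → T (mem D x y) → ¬ T (mem D′ x y) → x ≡ p × y ≡ q
removal-difference {D} {p} {q} {D′} {x} {y} removal xy∈D xy∉D′ =
  decidable-stable (x ≟ p ×-dec y ≟ q) (xy∉D′ ∘ removal-keeps {D} {p} {q} {D′} removal xy∈D)

IsMaximal : Ferrers → ℕ → ℕ → Set
IsMaximal D p q = ∀ {x y} → T (mem D x y) → p ≤ x → q ≤ y → x ≡ p × y ≡ q

removal-maximal : Removal D (p , q) D′ → IsMaximal D p q
removal-maximal {D} {p} {q} {D′} removal {x} {y} xy∈D p≤x q≤y =
  decidable-stable (x ≟ p ×-dec y ≟ q) λ xy≢pq →
    removal-drops {D} {p} {q} {D′} removal
      (downward D′ (removal-keeps {D} {p} {q} {D′} removal xy∈D xy≢pq) 1≤p p≤x 1≤q q≤y)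
  where
  1≤p : 1 ≤ p
  1≤p = proj₁ (positive D (proj₁ removal))
  1≤q : 1 ≤ q
  1≤q = proj₂ (positive D (proj₁ removal))

deleteCell : (D : Ferrers) (p q : ℕ) → IsMaximal D p q → Ferrers
deleteCell D p q maximal = record
  { mem      = λ x y → mem D x y ∧ not (isCell p q x y)
  ; bound    = bound D
  ; bounded  = bounded D ∘ kept
  ; positive = positive D ∘ kept
  ; downward = λ xy∈ 1≤i i≤x 1≤j j≤y →
      T-∧ .from (downward D (kept xy∈) 1≤i i≤x 1≤j j≤y , T-not (not-pq xy∈ i≤x j≤y))
  }
  where
  kept : ∀ {x y} → T (mem D x y ∧ not (isCell p q x y)) → T (mem D x y)
  kept = proj₁ ∘ T-∧ .to
  not-pq : ∀ {x y i j} → T (mem D x y ∧ not (isCell p q x y)) → i ≤ x → j ≤ y →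
           ¬ T (isCell p q i j)
  not-pq {x} {y} {i} {j} xy∈ i≤x j≤y ij=pq with isCell⇒≡ {p} {q} {i} {j} ij=pq
  ... | refl , refl with maximal (kept xy∈) i≤x j≤y
  ...   | refl , refl = T-not⇒¬T (proj₂ (T-∧ .to xy∈)) (isCell-refl {i} {j})

removal-deleteCell : (maximal : IsMaximal D p q) → T (mem D p q) →
                     Removal D (p , q) (deleteCell D p q maximal)
removal-deleteCell _ pq∈D = pq∈D , λ _ _ → refl

record Addable (D : Ferrers) (p q : ℕ) : Set where
  field
    row-positive : 1 ≤ p
    col-positive : 1 ≤ q
    fresh        : ¬ T (mem D p q)
    supported    : ∀ {i j} → 1 ≤ i → i ≤ p → 1 ≤ j → j ≤ q → i < p ⊎ j < q → T (mem D i j)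

addCell : (D : Ferrers) (p q : ℕ) → Addable D p q → Ferrers
addCell D p q addable = record
  { mem      = mem′
  ; bound    = B
  ; bounded  = bounded′
  ; positive = positive′
  ; downward = downward′
  }
  where
  open Addable addable
  mem′ : ℕ → ℕ → Bool
  mem′ x y = mem D x y ∨ isCell p q x y
  B : ℕ
  B = p ⊔ q ⊔ bound D
  old-or-new : ∀ {x y} → T (mem′ x y) → T (mem D x y) ⊎ (x ≡ p × y ≡ q)
  old-or-new {x} {y} xy∈ = map₂ (isCell⇒≡ {p} {q} {x} {y}) (T-∨ {mem D x y} .to xy∈)
  bounded′ : ∀ {x y} → T (mem′ x y) → x ≤ B × y ≤ B
  bounded′ xy∈ with old-or-new xy∈
  ... | inj₁ xy∈D = let (x≤ , y≤) = bounded D xy∈D in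
                    ≤-trans x≤ (m≤n⊔m (p ⊔ q) (bound D)) , ≤-trans y≤ (m≤n⊔m (p ⊔ q) (bound D))
  ... | inj₂ (refl , refl) = ≤-trans (m≤m⊔n p q) (m≤m⊔n (p ⊔ q) (bound D)) ,
                             ≤-trans (m≤n⊔m p q) (m≤m⊔n (p ⊔ q) (bound D))
  positive′ : ∀ {x y} → T (mem′ x y) → 1 ≤ x × 1 ≤ y
  positive′ xy∈ with old-or-new xy∈
  ... | inj₁ xy∈D = positive D xy∈D
  ... | inj₂ (refl , refl) = row-positive , col-positive
  downward′ : ∀ {x y i j} → T (mem′ x y) → 1 ≤ i → i ≤ x → 1 ≤ j → j ≤ y → T (mem′ i j)
  downward′ {i = i} {j} xy∈ 1≤i i≤x 1≤j j≤y with old-or-new xy∈ | i ≟ p | j ≟ q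
  ... | inj₁ xy∈D          | _        | _        =
    T-∨ .from (inj₁ (downward D xy∈D 1≤i i≤x 1≤j j≤y))
  ... | inj₂ (refl , refl) | yes refl | yes refl =
    T-∨ {mem D i j} .from (inj₂ (isCell-refl {i} {j}))
  ... | inj₂ (refl , refl) | no i≢p   | _        =
    T-∨ .from (inj₁ (supported 1≤i i≤x 1≤j j≤y (inj₁ (≤∧≢⇒< i≤x i≢p))))
  ... | inj₂ (refl , refl) | yes _    | no j≢q   =
    T-∨ .from (inj₁ (supported 1≤i i≤x 1≤j j≤y (inj₂ (≤∧≢⇒< j≤y j≢q))))

removal-addCell : (addable : Addable D p q) → Removal (addCell D p q addable) (p , q) D
removal-addCell {D} {p} {q} addable =
  T-∨ .from (inj₂ (isCell-refl {p} {q})) ,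
  λ x y → sym (∨-∧-not-absorb (mem D x y) (isCell p q x y) (fresh-at x y))
  where
  open Addable addable
  fresh-at : ∀ x y → T (isCell p q x y) → ¬ T (mem D x y)
  fresh-at x y xy=pq with isCell⇒≡ {p} {q} {x} {y} xy=pq
  ... | refl , refl = fresh
  ∨-∧-not-absorb : ∀ m e → (T e → ¬ T m) → (m ∨ e) ∧ not e ≡ m
  ∨-∧-not-absorb true  true  e⇒¬m = contradiction _ (e⇒¬m _)
  ∨-∧-not-absorb true  false _ = refl
  ∨-∧-not-absorb false true  _ = refl
  ∨-∧-not-absorb false false _ = refl

-- ν and ν_min under the removal of a cell

ν-count : ∀ (D : Ferrers) d j → bound D ≤ K →
          ν D d j ≡ count K (λ x y → mem D x y ∧ inQuadrant d j x y)
ν-count {K} D d j bound≤K = sym (count-extend (bound D) K (λ x y → mem D x y ∧ inQuadrant d j x y)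
                                               (λ t → bounded D (proj₁ (T-∧ .to t))) bound≤K)

ν-removal : ∀ d j → Removal D (p , q) D′ → ν D′ d j + iverson (inQuadrant d j p q) ≡ ν D d j
ν-removal {D} {p} {q} {D′} d j (pq∈D , D′≡D∖pq) = begin
  ν D′ d j + iverson (R p q)
    ≡⟨ cong₂ _+_ (ν-count D′ d j (m≤n⊔m (bound D) (bound D′)))
                 (sym (count-cell N R 1≤p p≤N 1≤q q≤N)) ⟩
  count N (λ x y → mem D′ x y ∧ R x y) + count N (λ x y → isCell p q x y ∧ R x y)
    ≡⟨ count-+ N (λ x y → mem D′ x y ∧ R x y) (λ x y → isCell p q x y ∧ R x y)
                 (λ x y → mem D x y ∧ R x y) pointwise ⟩
  count N (λ x y → mem D x y ∧ R x y)
    ≡⟨ ν-count D d j (m≤m⊔n (bound D) (bound D′)) ⟨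
  ν D d j ∎
  where
  open ≡-Reasoning
  N : ℕ
  N = bound D ⊔ bound D′
  R : ℕ → ℕ → Bool
  R = inQuadrant d j
  1≤p : 1 ≤ p
  1≤p = proj₁ (positive D pq∈D)
  1≤q : 1 ≤ q
  1≤q = proj₂ (positive D pq∈D)
  p≤N : p ≤ N
  p≤N = ≤-trans (proj₁ (bounded D pq∈D)) (m≤m⊔n (bound D) (bound D′))
  q≤N : q ≤ N
  q≤N = ≤-trans (proj₂ (bounded D pq∈D)) (m≤m⊔n (bound D) (bound D′))
  cell∈D : ∀ {x y} → T (isCell p q x y) → T (mem D x y)
  cell∈D {x} {y} t with isCell⇒≡ {p} {q} {x} {y} t
  ... | refl , refl = pq∈D
  pointwise : ∀ x y → iverson (mem D′ x y ∧ R x y) + iverson (isCell p q x y ∧ R x y) ≡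
                      iverson (mem D x y ∧ R x y)
  pointwise x y rewrite D′≡D∖pq x y = iverson-split (mem D x y) (isCell p q x y) (R x y) cell∈D

ν-removal-≤ : ∀ d j → Removal D (p , q) D′ → ν D′ d j ≤ ν D d j
ν-removal-≤ {D} {D′ = D′} d j removal =
  subst (ν D′ d j ≤_) (ν-removal {D = D} {D′ = D′} d j removal) (m≤m+n _ _)

ν-removal-counted : ∀ d j → Removal D (p , q) D′ → T (inQuadrant d j p q) → ν D d j ≡ suc (ν D′ d j)
ν-removal-counted {D} {p} {q} {D′} d j removal counted = begin
  ν D d j                                   ≡⟨ ν-removal {D = D} {D′ = D′} d j removal ⟨
  ν D′ d j + iverson (inQuadrant d j p q)     ≡⟨ cong (ν D′ d j +_) (iverson-T counted) ⟩
  ν D′ d j + 1                              ≡⟨ +-comm (ν D′ d j) 1 ⟩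
  suc (ν D′ d j)                            ∎
  where open ≡-Reasoning

ν-removal-uncounted : ∀ d j → Removal D (p , q) D′ → ¬ T (inQuadrant d j p q) → ν D′ d j ≡ ν D d j
ν-removal-uncounted {D} {p} {q} {D′} d j removal uncounted = begin
  ν D′ d j                                  ≡⟨ +-identityʳ (ν D′ d j) ⟨
  ν D′ d j + 0                              ≡⟨ cong (ν D′ d j +_) (iverson-¬T uncounted) ⟨
  ν D′ d j + iverson (inQuadrant d j p q)     ≡⟨ ν-removal {D = D} {D′ = D′} d j removal ⟩
  ν D d j                                   ∎
  where open ≡-Reasoning

νmin-removal-≡ : ∀ k → Removal D (p , q) D′ → j ≤ k → ν D (suc k) j ≡ 0 →
                 νmin D′ (suc k) ≡ νmin D (suc k)
νmin-removal-≡ {D} {p} {q} {D′} {j} k removal j≤k νⱼ≡0 =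
  trans (min≡0 (ν D′ (suc k)) ν′ⱼ≡0) (sym (min≡0 (ν D (suc k)) νⱼ≡0))
  where
  ν′ⱼ≡0 : ν D′ (suc k) j ≡ 0
  ν′ⱼ≡0 = n≤0⇒n≡0 (subst (ν D′ (suc k) j ≤_) νⱼ≡0 (ν-removal-≤ {D} {p} {q} {D′} (suc k) j removal))
  min≡0 : ∀ f → f j ≡ 0 → minUpTo k f ≡ 0
  min≡0 f fⱼ≡0 = n≤0⇒n≡0 (≤-trans (minUpTo-≤ k f j≤k) (≤-reflexive fⱼ≡0))

νmin-removal-suc : ∀ k → Removal D (p , q) D′ → (∀ j → j ≤ k → T (inQuadrant (suc k) j p q)) →
                   νmin D (suc k) ≡ suc (νmin D′ (suc k))
νmin-removal-suc {D} {p} {q} {D′} k removal counted =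
  minUpTo-suc k (ν D′ (suc k)) (ν D (suc k)) λ j j≤k →
    ν-removal-counted {D} {p} {q} {D′} (suc k) j removal (counted j j≤k)

νmin-extension-< : ∀ k {s} → Removal E (p , q) D → s ≤ k → T (inQuadrant (suc k) s p q) →
                   (∀ i → i ≤ k → i ≢ s → ν D (suc k) s < ν D (suc k) i) →
                   νmin D (suc k) < νmin E (suc k)
νmin-extension-< {E} {p} {q} {D} k {s} removal s≤k counted unique = begin-strict
  νmin D (suc k)    ≤⟨ minUpTo-≤ k (ν D (suc k)) s≤k ⟩
  ν D (suc k) s     <⟨ minUpTo-glb k (ν E (suc k)) above ⟩
  νmin E (suc k)    ∎
  where
  open ≤-Reasoning
  above : ∀ i → i ≤ k → ν D (suc k) s < ν E (suc k) i
  above i i≤k with i ≟ s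
  ... | yes refl = ≤-reflexive (sym (ν-removal-counted {E} {p} {q} {D} (suc k) i removal counted))
  ... | no i≢s   = <-≤-trans (unique i i≤k i≢s) (ν-removal-≤ {E} {p} {q} {D} (suc k) i removal)

νmin-extension-≡ : ∀ k {s t} → Removal E (p , q) D →
                   s ≤ k → s ≢ t → ν D (suc k) s ≡ ν D (suc k) t →
                   (∀ i → i ≤ k → i ≢ t → ¬ T (inQuadrant (suc k) i p q)) →
                   νmin E (suc k) ≡ νmin D (suc k)
νmin-extension-≡ {E} {p} {q} {D} k removal s≤k s≢t νₛ≡νₜ uncounted =
  minUpTo-raise k (ν D (suc k)) (ν E (suc k)) s≤k s≢t νₛ≡νₜ
    (λ i _ → ν-removal-≤ {E} {p} {q} {D} (suc k) i removal)
    (λ i i≤k i≢t → sym (ν-removal-uncounted {E} {p} {q} {D} (suc k) i removal (uncounted i i≤k i≢t)))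

ν≡0⇒reducible : ∀ k → Removal D (p , q) D′ → j ≤ k → ν D (suc k) j ≡ 0 → ¬ Irreducible D (suc k)
ν≡0⇒reducible {D} {p} {q} {D′} k removal j≤k νⱼ≡0 irreducible =
  irreducible (D′ , inj₁ ((p , q) , removal , νmin-removal-≡ {D} {p} {q} {D′} k removal j≤k νⱼ≡0))

νmin<⇒reducible : ∀ d → Removal E (p , q) D → νmin D d < νmin E d → ¬ Irreducible D d
νmin<⇒reducible {E} {p} {q} d removal νmin< irreducible =
  irreducible (E , inj₂ ((p , q) , removal , <⇒≢ νmin<))

-- Rectangles

rectMem⇒ : T (rectMem a b x y) → x ≤ a × y ≤ b
rectMem⇒ {a} {b} {x} {y} xy∈ =
  let (_ , x≤a∧rest) = T-∧ {1 ≤ᵇ x} .to xy∈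
      (x≤a , y∈)     = T-∧ {x ≤ᵇ a} .to x≤a∧rest
      (_ , y≤b)      = T-∧ {1 ≤ᵇ y} .to y∈
  in ≤ᵇ⇒≤ x a x≤a , ≤ᵇ⇒≤ y b y≤b

rectMem⇐ : 1 ≤ x → x ≤ a → 1 ≤ y → y ≤ b → T (rectMem a b x y)
rectMem⇐ 1≤x x≤a 1≤y y≤b =
  T-∧ .from (≤⇒≤ᵇ 1≤x ,
  T-∧ .from (≤⇒≤ᵇ x≤a ,
  T-∧ .from (≤⇒≤ᵇ 1≤y , ≤⇒≤ᵇ y≤b)))

-- For x, y ≥ 1 the guards 1 ≤ᵇ x and 1 ≤ᵇ y in rectMem compute to true, so each summand
-- splits into a row indicator times a column indicator.
ν-rect : ∀ a b d j → j < d → ν (rect a b) d j ≡ (suc a ∸ (d ∸ j)) * (b ∸ j)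
ν-rect a b d j j<d = begin
  ν (rect a b) d j
    ≡⟨ sumTo-cong N (λ x _ → sumTo-cong N λ y _ →
         iverson-medial (suc x ≤ᵇ a) (suc y ≤ᵇ b) ((d ∸ j) ≤ᵇ suc x) (suc j ≤ᵇ suc y)) ⟩
  sumTo N (λ x → sumTo N (λ y → rows x * cols y))
    ≡⟨ sumTo-cong N (λ x _ → sumTo-*ˡ N (rows (suc x))) ⟩
  sumTo N (λ x → rows x * sumTo N cols)
    ≡⟨ sumTo-*ʳ N (sumTo N cols) ⟩
  sumTo N rows * sumTo N cols
    ≡⟨ cong₂ _*_ (sumTo-interval N a (m<n⇒0<n∸m j<d) (m≤m⊔n a b))
                 (sumTo-interval N b (s≤s z≤n) (m≤n⊔m a b)) ⟩
  (suc a ∸ (d ∸ j)) * (b ∸ j) ∎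
  where
  open ≡-Reasoning
  N : ℕ
  N = a ⊔ b
  rows cols : ℕ → ℕ
  rows x = iverson ((x ≤ᵇ a) ∧ ((d ∸ j) ≤ᵇ x))
  cols y = iverson ((y ≤ᵇ b) ∧ (suc j ≤ᵇ y))

ν-rect-transpose : ∀ a b d j → j < d → ν (rect a b) d j ≡ ν (rect b a) d (d ∸ suc j)
ν-rect-transpose a b d j j<d = begin
  ν (rect a b) d j
    ≡⟨ ν-rect a b d j j<d ⟩
  (suc a ∸ (d ∸ j)) * (b ∸ j)
    ≡⟨ cong (λ e → (suc a ∸ e) * (b ∸ j)) (+-∸-assoc 1 j<d) ⟩
  (a ∸ (d ∸ suc j)) * (b ∸ j)
    ≡⟨ *-comm (a ∸ (d ∸ suc j)) (b ∸ j) ⟩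
  (b ∸ j) * (a ∸ (d ∸ suc j))
    ≡⟨ cong (λ e → (suc b ∸ e) * (a ∸ (d ∸ suc j))) (m∸[m∸n]≡n j<d) ⟨
  (suc b ∸ (d ∸ (d ∸ suc j))) * (a ∸ (d ∸ suc j))
    ≡⟨ ν-rect b a d (d ∸ suc j) (∸-monoʳ-< {o = 0} (s≤s z≤n) j<d) ⟨
  ν (rect b a) d (d ∸ suc j) ∎
  where open ≡-Reasoning

ν-square-ends : ∀ a k → ν (rect a a) (suc (suc k)) (suc k) ≡ ν (rect a a) (suc (suc k)) 0
ν-square-ends a k =
  trans (ν-rect-transpose a a (suc (suc k)) (suc k) ≤-refl) (cong (ν (rect a a) (suc (suc k))) (n∸n≡0 k))

ν-rect-0<ν-rect : ∀ a b d j → d ≤ suc a → a < b → 1 ≤ j → j < d →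
                  ν (rect a b) d 0 < ν (rect a b) d j
ν-rect-0<ν-rect a b d j d≤1+a a<b 1≤j j<d = begin-strict
  ν (rect a b) d 0          ≡⟨ ν-rect a b d 0 (≤-trans (s≤s z≤n) j<d) ⟩
  c * b                     ≡⟨ cong (c *_) (m∸n+n≡m j≤b) ⟨
  c * (w + j)               <⟨ m*[n+o]<[m+o]*n c<w 1≤j ⟩
  (c + j) * w               ≡⟨ cong (_* w) (m∸[n∸o]≡m∸n+o (<⇒≤ j<d) d≤1+a) ⟨
  (suc a ∸ (d ∸ j)) * w     ≡⟨ ν-rect a b d j j<d ⟨
  ν (rect a b) d j          ∎
  where
  open ≤-Reasoning
  c w : ℕ
  c = suc a ∸ d
  w = b ∸ j
  j≤b : j ≤ b
  j≤b = ≤-trans (≤-pred (≤-trans j<d d≤1+a)) (<⇒≤ a<b)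
  c<w : c < w
  c<w = +-cancelʳ-< j c w (begin-strict
    c + j    <⟨ +-monoʳ-< c j<d ⟩
    c + d    ≡⟨ m∸n+n≡m d≤1+a ⟩
    suc a    ≤⟨ a<b ⟩
    b        ≡⟨ m∸n+n≡m j≤b ⟨
    w + j    ∎)

ν-rect-last<ν-rect : ∀ a b k i → suc (suc k) ≤ suc b → b < a → i < suc k →
                     ν (rect a b) (suc (suc k)) (suc k) < ν (rect a b) (suc (suc k)) i
ν-rect-last<ν-rect a b k i d≤1+b b<a i<1+k = begin-strict
  ν (rect a b) d (suc k)            ≡⟨ ν-rect-transpose a b d (suc k) ≤-refl ⟩
  ν (rect b a) d (k ∸ k)            ≡⟨ cong (ν (rect b a) d) (n∸n≡0 k) ⟩
  ν (rect b a) d 0                  <⟨ ν-rect-0<ν-rect b a d (d ∸ suc i) d≤1+b b<a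
                                         (m<n⇒0<n∸m (s≤s i<1+k))
                                         (∸-monoʳ-< {o = 0} (s≤s z≤n) (m≤n⇒m≤1+n i<1+k)) ⟩
  ν (rect b a) d (d ∸ suc i)        ≡⟨ ν-rect-transpose a b d i (m<n⇒m<1+n i<1+k) ⟨
  ν (rect a b) d i                  ∎
  where
  open ≤-Reasoning
  d : ℕ
  d = suc (suc k)

rect-maximal : ∀ a b → IsMaximal (rect a b) a b
rect-maximal a b xy∈ a≤x b≤y =
  let (x≤a , y≤b) = rectMem⇒ xy∈ in ≤-antisym x≤a a≤x , ≤-antisym y≤b b≤y

rect∖corner : ℕ → ℕ → Ferrers
rect∖corner a b = deleteCell (rect a b) a b (rect-maximal a b)

removal-rect∖corner : 1 ≤ a → 1 ≤ b → Removal (rect a b) (a , b) (rect∖corner a b)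
removal-rect∖corner {a} {b} 1≤a 1≤b =
  removal-deleteCell {rect a b} (rect-maximal a b) (rectMem⇐ 1≤a ≤-refl 1≤b ≤-refl)

rect-removal-cell : Removal (rect a b) (p , q) D′ → a ≡ p × b ≡ q
rect-removal-cell {a} {b} {p} {q} {D′} removal@(pq∈rect , _)
  with positive (rect a b) {p} {q} pq∈rect | rectMem⇒ {a} {b} {p} {q} pq∈rect
... | 1≤p , 1≤q | p≤a , q≤b =
  removal-maximal {rect a b} {p} {q} {D′} removal
    (rectMem⇐ (≤-trans 1≤p p≤a) ≤-refl (≤-trans 1≤q q≤b) ≤-refl) p≤a q≤b

rect-addable-row : 1 ≤ b → Addable (rect a b) (suc a) 1
rect-addable-row {b} {a} 1≤b = record
  { row-positive = s≤s z≤n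
  ; col-positive = ≤-refl
  ; fresh        = λ t → <-irrefl refl (proj₁ (rectMem⇒ {a} {b} {suc a} {1} t))
  ; supported    = λ where
      1≤i i≤1+a 1≤j j≤1 (inj₁ i<1+a) → rectMem⇐ 1≤i (≤-pred i<1+a) 1≤j (≤-trans j≤1 1≤b)
      1≤i i≤1+a 1≤j j≤1 (inj₂ j<1)   → contradiction 1≤j (<⇒≱ j<1)
  }

rect-addable-col : 1 ≤ a → Addable (rect a b) 1 (suc b)
rect-addable-col {a} {b} 1≤a = record
  { row-positive = ≤-refl
  ; col-positive = s≤s z≤n
  ; fresh        = λ t → <-irrefl refl (proj₂ (rectMem⇒ {a} {b} {1} {suc b} t))
  ; supported    = λ where
      1≤i i≤1 1≤j j≤1+b (inj₁ i<1)   → contradiction 1≤i (<⇒≱ i<1)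
      1≤i i≤1 1≤j j≤1+b (inj₂ j<1+b) → rectMem⇐ 1≤i (≤-trans i≤1 1≤a) 1≤j (≤-pred j<1+b)
  }

rect+row : ∀ a b → 1 ≤ b → Ferrers
rect+row a b 1≤b = addCell (rect a b) (suc a) 1 (rect-addable-row 1≤b)

rect+col : ∀ a b → 1 ≤ a → Ferrers
rect+col a b 1≤a = addCell (rect a b) 1 (suc b) (rect-addable-col 1≤a)

rect-extension-cell : Removal E (p , q) (rect a b) → (suc a ≡ p × 1 ≡ q) ⊎ (1 ≡ p × suc b ≡ q)
rect-extension-cell {E} {p} {q} {a} {b} removal@(pq∈E , _) with positive E pq∈E | p ≤? a | q ≤? b
... | 1≤p , 1≤q | yes p≤a | yes q≤b =
  contradiction (rectMem⇐ 1≤p p≤a 1≤q q≤b) (removal-drops {E} {p} {q} {rect a b} removal)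
... | 1≤p , 1≤q | no p≰a  | _ =
  inj₁ (removal-difference {E} {p} {q} {rect a b} removal
          (downward E pq∈E (s≤s z≤n) (≰⇒> p≰a) ≤-refl 1≤q)
          (λ t → <-irrefl refl (proj₁ (rectMem⇒ {a} {b} {suc a} {1} t))))
... | 1≤p , 1≤q | yes _   | no q≰b =
  inj₂ (removal-difference {E} {p} {q} {rect a b} removal
          (downward E pq∈E ≤-refl 1≤p (s≤s z≤n) (≰⇒> q≰b))
          (λ t → <-irrefl refl (proj₂ (rectMem⇒ {a} {b} {1} {suc b} t))))

-- Irreducible rectangles

irreducible-rect⇒d≤a : ∀ a b k → 1 ≤ a → 1 ≤ b → Irreducible (rect a b) (suc (suc k)) →
                       suc (suc k) ≤ a
irreducible-rect⇒d≤a a b k 1≤a 1≤b irreducible = decidable-stable (suc (suc k) ≤? a) λ d≰a →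
  ν≡0⇒reducible {D = rect a b} {D′ = rect∖corner a b} (suc k) (removal-rect∖corner 1≤a 1≤b) z≤n
    (begin
      ν (rect a b) (suc (suc k)) 0    ≡⟨ ν-rect a b (suc (suc k)) 0 (s≤s z≤n) ⟩
      (suc a ∸ suc (suc k)) * b       ≡⟨ cong (_* b) (m≤n⇒m∸n≡0 (≰⇒> d≰a)) ⟩
      0                               ∎)
    irreducible
  where open ≡-Reasoning

irreducible-rect⇒d≤b : ∀ a b k → 1 ≤ a → 1 ≤ b → Irreducible (rect a b) (suc (suc k)) →
                       suc (suc k) ≤ b
irreducible-rect⇒d≤b a b k 1≤a 1≤b irreducible = decidable-stable (suc (suc k) ≤? b) λ d≰b →
  ν≡0⇒reducible {D = rect a b} {D′ = rect∖corner a b} (suc k) (removal-rect∖corner 1≤a 1≤b) ≤-refl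
    (begin
      ν (rect a b) (suc (suc k)) (suc k)   ≡⟨ ν-rect a b (suc (suc k)) (suc k) ≤-refl ⟩
      rows * (b ∸ suc k)                   ≡⟨ cong (rows *_) (m≤n⇒m∸n≡0 (≤-pred (≰⇒> d≰b))) ⟩
      rows * 0                             ≡⟨ *-zeroʳ rows ⟩
      0                                    ∎)
    irreducible
  where
  open ≡-Reasoning
  rows : ℕ
  rows = suc a ∸ (suc (suc k) ∸ suc k)

irreducible-rect⇒a≮b : ∀ a b k → 1 ≤ b → suc (suc k) ≤ a → Irreducible (rect a b) (suc (suc k)) →
                       ¬ a < b
irreducible-rect⇒a≮b a b k 1≤b d≤a irreducible a<b =
  νmin<⇒reducible {E = rect+row a b 1≤b} {D = rect a b} (suc (suc k)) removal
    (νmin-extension-< {E = rect+row a b 1≤b} {D = rect a b} (suc k) removal z≤n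
       (inQuadrant-intro (suc (suc k)) 0 (m≤n⇒m≤1+n d≤a) ≤-refl)
       λ i i≤1+k i≢0 →
         ν-rect-0<ν-rect a b (suc (suc k)) i (m≤n⇒m≤1+n d≤a) a<b (n≢0⇒n>0 i≢0) (s≤s i≤1+k))
    irreducible
  where
  removal : Removal (rect+row a b 1≤b) (suc a , 1) (rect a b)
  removal = removal-addCell (rect-addable-row 1≤b)

irreducible-rect⇒b≮a : ∀ a b k → 1 ≤ a → suc (suc k) ≤ b → Irreducible (rect a b) (suc (suc k)) →
                       ¬ b < a
irreducible-rect⇒b≮a a b k 1≤a d≤b irreducible b<a =
  νmin<⇒reducible {E = rect+col a b 1≤a} {D = rect a b} (suc (suc k)) removal
    (νmin-extension-< {E = rect+col a b 1≤a} {D = rect a b} (suc k) removal ≤-refl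
       (inQuadrant-intro (suc (suc k)) (suc k) (≤-reflexive (m+n∸n≡m 1 k)) (m≤n⇒m≤1+n d≤b))
       λ i i≤1+k i≢1+k →
         ν-rect-last<ν-rect a b k i (m≤n⇒m≤1+n d≤b) b<a (≤∧≢⇒< i≤1+k i≢1+k))
    irreducible
  where
  removal : Removal (rect+col a b 1≤a) (1 , suc b) (rect a b)
  removal = removal-addCell (rect-addable-col 1≤a)

irreducible-rect⇒square : ∀ a b k → 1 ≤ a → 1 ≤ b → Irreducible (rect a b) (suc (suc k)) →
                          a ≡ b × suc (suc k) ≤ a
irreducible-rect⇒square a b k 1≤a 1≤b irreducible =
  ≤-antisym (≮⇒≥ (irreducible-rect⇒b≮a a b k 1≤a d≤b irreducible))
            (≮⇒≥ (irreducible-rect⇒a≮b a b k 1≤b d≤a irreducible)) ,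
  d≤a
  where
  d≤a : suc (suc k) ≤ a
  d≤a = irreducible-rect⇒d≤a a b k 1≤a 1≤b irreducible
  d≤b : suc (suc k) ≤ b
  d≤b = irreducible-rect⇒d≤b a b k 1≤a 1≤b irreducible

square-removal-νmin : ∀ a k → suc (suc k) ≤ a → Removal (rect a a) (p , q) D′ →
                      νmin (rect a a) (suc (suc k)) ≡ suc (νmin D′ (suc (suc k)))
square-removal-νmin {p} {q} {D′} a k d≤a removal with rect-removal-cell {a} {a} {p} {q} {D′} removal
... | refl , refl = νmin-removal-suc {rect a a} {a} {a} {D′} (suc k) removal λ j j≤1+k →
  inQuadrant-intro (suc (suc k)) j (≤-trans (m∸n≤m (suc (suc k)) j) d≤a) (≤-trans (s≤s j≤1+k) d≤a)

square-extension-νmin : ∀ a k → Removal E (p , q) (rect a a) →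
                        νmin E (suc (suc k)) ≡ νmin (rect a a) (suc (suc k))
square-extension-νmin {E} {p} {q} a k removal with rect-extension-cell {E} {p} {q} {a} {a} removal
... | inj₁ (refl , refl) =
  νmin-extension-≡ {E} {suc a} {1} {rect a a} (suc k) removal ≤-refl (λ ()) (ν-square-ends a k)
    λ i _ i≢0 → inQuadrant-first-column (suc (suc k)) {i} {suc a} (n≢0⇒n>0 i≢0)
... | inj₂ (refl , refl) =
  νmin-extension-≡ {E} {1} {suc a} {rect a a} (suc k) removal z≤n (λ ()) (sym (ν-square-ends a k))
    λ i i≤1+k i≢1+k → inQuadrant-first-row (suc (suc k)) {i} {suc a} (s≤s (≤∧≢⇒< i≤1+k i≢1+k))

square-irreducible : ∀ a k → suc (suc k) ≤ a → Irreducible (rect a a) (suc (suc k))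
square-irreducible a k d≤a (D′ , inj₁ ((p , q) , removal , νmin≡)) =
  1+n≢n (trans (sym (square-removal-νmin {p} {q} {D′} a k d≤a removal)) (sym νmin≡))
square-irreducible a k d≤a (E , inj₂ ((p , q) , removal , νmin≢)) =
  νmin≢ (sym (square-extension-νmin {E} {p} {q} a k removal))

lemma4p3 : (a b d : ℕ) → 1 ≤ a → 1 ≤ b → 2 ≤ d →
    Irreducible (rect a b) d ⇔ (a ≡ b × d ≤ a)
lemma4p3 a b (suc zero) _ _ (s≤s ())
lemma4p3 a b (suc (suc k)) 1≤a 1≤b _ =
  mk⇔ (irreducible-rect⇒square a b k 1≤a 1≤b) square⇒irreducible
  where
  square⇒irreducible : a ≡ b × suc (suc k) ≤ a → Irreducible (rect a b) (suc (suc k))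
  square⇒irreducible (refl , d≤a) = square-irreducible a k d≤a
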